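{- Let $X$ be a connected bipartite graph and let $C_X$ be the graph with vertex set $P\cup Q\cup R$, where $P=\{p_i: x_i\in V(X)\}$, $Q=\{q_{ik}: x_i\in e_k\}$, $R=\{r_k: e_k\in E(X)\}$, and edge set $\{p_iq_{ik},\,q_{ik}r_k : x_i\in e_k\}$. Then $\dim(C_X)\le 4$, i.e., there are four linear orders $L_1,L_2,L_3,L_4$ on $V(C_X)$ such that two distinct vertices are comparable in $L_1\cap L_2\cap L_3\cap L_4$ if and only if they are adjacent in $C_X$.
   Context: Here $V(X)=\{x_1,\dots,x_n\}$ and $E(X)=\{e_1,\dots,e_m\}$. The dimension $\dim(Y)$ of a comparability graph $Y$ is the least $k$ such that $Y$ is the comparability graph of a partial order that is the intersection of $k$ linear orders on $V(Y)$. -}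

module Defs where

open import Level using (0ℓ)
open import Data.Nat using (ℕ)
open import Data.Fin using (Fin)
open import Data.Bool using (Bool)
open import Data.Product using (Σ; ∃; _×_; _,_; proj₁)
open import Data.Sum using (_⊎_; inj₁; inj₂)
open import Relation.Nullary using (¬_)
open import Relation.Binary using (Rel; IsStrictTotalOrder)
open import Relation.Binary.PropositionalEquality using (_≡_; _≢_)
open import Relation.Binary.Construct.Closure.ReflexiveTransitive using (Star)
open import Function.Bundles using (_⇔_)

-- A finite simple graph X with vertices x_0..x_{n-1} (Fin n) and
-- edges e_0..e_{m-1} (Fin m); edge e_k = {end₁ k , end₂ k}.
record Graph (n m : ℕ) : Set where
  field
    end₁ end₂ : Fin m → Fin n
    loopless  : ∀ k → end₁ k ≢ end₂ k
    distinct  : ∀ k l → k ≢ l →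
                ¬ ((end₁ k ≡ end₁ l × end₂ k ≡ end₂ l) ⊎
                   (end₁ k ≡ end₂ l × end₂ k ≡ end₁ l))

module _ {n m : ℕ} (X : Graph n m) where
  open Graph X

  _∈E_ : Fin n → Fin m → Set
  i ∈E k = (i ≡ end₁ k) ⊎ (i ≡ end₂ k)

  Adj : Rel (Fin n) 0ℓ
  Adj i j = ∃ λ k → (i ≡ end₁ k × j ≡ end₂ k) ⊎ (i ≡ end₂ k × j ≡ end₁ k)

  Connected : Set
  Connected = ∀ i j → Star Adj i j

  Bipartite : Set
  Bipartite = Σ (Fin n → Bool) λ c → ∀ k → c (end₁ k) ≢ c (end₂ k)

  data VC : Set where
    p : Fin n → VC
    q : (i : Fin n) (k : Fin m) → i ∈E k → VC
    r : Fin m → VC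

  data AdjC : VC → VC → Set where
    pq : ∀ i k (h : i ∈E k) → AdjC (p i) (q i k h)
    qp : ∀ i k (h : i ∈E k) → AdjC (q i k h) (p i)
    qr : ∀ i k (h : i ∈E k) → AdjC (q i k h) (r k)
    rq : ∀ i k (h : i ∈E k) → AdjC (r k) (q i k h)

LinearOrder : Set → Set₁
LinearOrder A = Σ (Rel A 0ℓ) λ _<_ → IsStrictTotalOrder _≡_ _<_

ComparableIn : {A : Set} {t : ℕ} → (Fin t → LinearOrder A) → A → A → Set
ComparableIn {t = t} L a b =
  (∀ s → proj₁ (L s) a b) ⊎ (∀ s → proj₁ (L s) b a)

module Submission where

open import Defs
open import Data.Nat using (ℕ)
open import Data.Fin using (Fin)
open import Relation.Binary.PropositionalEquality using (_≢_)
open import Data.Product using (Σ)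
open import Function.Bundles using (_⇔_)

open import Level using (0ℓ)
open import Data.Nat using (suc; _<_; _>_; z≤n; s≤s)
open import Data.Nat.Properties using (<-isStrictTotalOrder; <-irrefl; <-asym; suc-injective)
open import Data.Fin as Fin using (toℕ; _≟_)
open import Data.Fin.Properties using (toℕ-injective)
open import Data.Product using (_×_; _,_; proj₁; proj₂)
open import Data.Product.Relation.Binary.Pointwise.NonDependent using (Pointwise)
open import Data.Product.Relation.Binary.Lex.Strict using (×-Lex; ×-isStrictTotalOrder)
open import Data.Sum using (_⊎_; inj₁; inj₂; [_,_])
open import Data.Empty using (⊥-elim)
open import Function.Base using (_on_)
open import Function.Definitions using (Injective)
open import Function.Bundles using (mk⇔)
open import Relation.Binary using (Rel; IsStrictTotalOrder; Trichotomous; tri<; tri≈; tri>)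
open import Relation.Binary.Structures.Biased using (isStrictTotalOrderᶜ)
import Relation.Binary.Construct.Flip.EqAndOrd as Flip
open import Relation.Binary.PropositionalEquality
  using (_≡_; refl; sym; trans; cong; isEquivalence)
open import Axiom.UniquenessOfIdentityProofs using (module Decidable⇒UIP)

-- Give every vertex of C_X a key (layer, block, height) ∈ ℕ³
-- and order keys lexicographically, reading the middle coordinate either
-- upwards or downwards.  The two resulting linear orders agree exactly on
-- the "block order" ◁: a lower layer is below a higher one, and inside a
-- layer only keys of the same block are comparable, by height.  Using two
-- keys, one whose blocks are the stars {p_i} ∪ {q_ik}_k (with R as the lower
-- layer) and one whose blocks are the stars {r_k} ∪ {q_ik}_i (with P as the
-- lower layer), we get four linear orders whose intersection is precisely
-- "p_i below q_ik and r_k below q_ik", i.e. the adjacency of C_X.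

pullback : ∀ {A B : Set} {_≈_ _<_ : Rel B 0ℓ} → IsStrictTotalOrder _≈_ _<_ →
           (f : A → B) → Injective _≡_ _≈_ f → IsStrictTotalOrder _≡_ (_<_ on f)
pullback {_≈_ = _≈_} {_<_} sto f f-inj = isStrictTotalOrderᶜ record
  { isEquivalence = isEquivalence
  ; trans         = S.trans
  ; compare       = compare
  }
  where
  module S = IsStrictTotalOrder sto

  image-≈ : ∀ {x y} → x ≡ y → f x ≈ f y
  image-≈ refl = S.Eq.refl

  compare : Trichotomous _≡_ (_<_ on f)
  compare x y with S.compare (f x) (f y)
  ... | tri< lt ¬eq ¬gt = tri< lt (λ e → ¬eq (image-≈ e)) ¬gt
  ... | tri≈ ¬lt eq ¬gt = tri≈ ¬lt (f-inj eq) ¬gt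
  ... | tri> ¬lt ¬eq gt = tri> ¬lt (λ e → ¬eq (image-≈ e)) gt

Key : Set
Key = ℕ × ℕ × ℕ

_≈ᴷ_ : Rel Key 0ℓ
_≈ᴷ_ = Pointwise _≡_ (Pointwise _≡_ _≡_)

Lex : Rel ℕ 0ℓ → Rel Key 0ℓ
Lex _≺_ = ×-Lex _≡_ _<_ (×-Lex _≡_ _≺_ _<_)

Lex-isStrictTotalOrder : ∀ {_≺_ : Rel ℕ 0ℓ} → IsStrictTotalOrder _≡_ _≺_ →
                         IsStrictTotalOrder _≈ᴷ_ (Lex _≺_)
Lex-isStrictTotalOrder sto =
  ×-isStrictTotalOrder <-isStrictTotalOrder (×-isStrictTotalOrder sto <-isStrictTotalOrder)

keyOrder : ∀ {A : Set} (_≺_ : Rel ℕ 0ℓ) → IsStrictTotalOrder _≡_ _≺_ →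
           (key : A → Key) → Injective _≡_ _≈ᴷ_ key → LinearOrder A
keyOrder _≺_ sto key key-inj =
  (Lex _≺_ on key) , pullback (Lex-isStrictTotalOrder sto) key key-inj

ascending : IsStrictTotalOrder _≡_ _<_
ascending = <-isStrictTotalOrder

descending : IsStrictTotalOrder _≡_ _>_
descending = Flip.isStrictTotalOrder <-isStrictTotalOrder

data _◁_ : Rel Key 0ℓ where
  across : ∀ {a x c a′ x′ c′} → a < a′ → (a , x , c) ◁ (a′ , x′ , c′)
  within : ∀ {a x c a′ x′ c′} → a ≡ a′ → x ≡ x′ → c < c′ →
           (a , x , c) ◁ (a′ , x′ , c′)

◁⇒Lex : ∀ (_≺_ : Rel ℕ 0ℓ) {s t} → s ◁ t → Lex _≺_ s t
◁⇒Lex _ (across lt)       = inj₁ lt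
◁⇒Lex _ (within e₁ e₂ lt) = inj₂ (e₁ , inj₂ (e₂ , lt))

Lex-up-down⇒◁ : ∀ {s t} → Lex _<_ s t → Lex _>_ s t → s ◁ t
Lex-up-down⇒◁ (inj₁ lt)                      _                           = across lt
Lex-up-down⇒◁ (inj₂ (e₁ , inj₂ (e₂ , lt)))    _                           = within e₁ e₂ lt
Lex-up-down⇒◁ (inj₂ (e₁ , inj₁ _))            (inj₁ lt)                   = ⊥-elim (<-irrefl e₁ lt)
Lex-up-down⇒◁ (inj₂ (_  , inj₁ up))           (inj₂ (_ , inj₁ down))      = ⊥-elim (<-asym up down)
Lex-up-down⇒◁ (inj₂ (_  , inj₁ up))           (inj₂ (_ , inj₂ (e₂ , _)))  = ⊥-elim (<-irrefl e₂ up)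

module Construction {n m : ℕ} (X : Graph n m) where
  open Graph X

  V : Set
  V = VC X

  -- Incidence proofs carry no information, since an edge is not a loop.
  ∈E-irrelevant : ∀ {i k} (h h′ : _∈E_ X i k) → h ≡ h′
  ∈E-irrelevant (inj₁ e) (inj₁ e′) = cong inj₁ (Decidable⇒UIP.≡-irrelevant _≟_ e e′)
  ∈E-irrelevant (inj₁ e) (inj₂ e′) = ⊥-elim (loopless _ (trans (sym e) e′))
  ∈E-irrelevant (inj₂ e) (inj₁ e′) = ⊥-elim (loopless _ (trans (sym e′) e))
  ∈E-irrelevant (inj₂ e) (inj₂ e′) = cong inj₂ (Decidable⇒UIP.≡-irrelevant _≟_ e e′)

  q-cong : ∀ {i j k l h h′} → i ≡ j → k ≡ l → q {X = X} i k h ≡ q j l h′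
  q-cong {h = h} {h′} refl refl = cong (q _ _) (∈E-irrelevant h h′)

  -- Blocks are the stars of the p_i; R forms the lower layer.
  keyᴾ : V → Key
  keyᴾ (p i)     = 1 , toℕ i , 0
  keyᴾ (q i k _) = 1 , toℕ i , suc (toℕ k)
  keyᴾ (r k)     = 0 , toℕ k , 0

  -- Blocks are the stars of the r_k; P forms the lower layer.
  keyᴿ : V → Key
  keyᴿ (p i)     = 0 , toℕ i , 0
  keyᴿ (q i k _) = 1 , toℕ k , suc (toℕ i)
  keyᴿ (r k)     = 1 , toℕ k , 0

  keyᴾ-injective : Injective _≡_ _≈ᴷ_ keyᴾ
  keyᴾ-injective {p i}     {p j}      (_ , e , _)   = cong p (toℕ-injective e)
  keyᴾ-injective {p i}     {q j k h}  (_ , _ , ())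
  keyᴾ-injective {p i}     {r k}      (() , _)
  keyᴾ-injective {q i k h} {p j}      (_ , _ , ())
  keyᴾ-injective {q i k h} {q j l h′} (_ , e , e′)  =
    q-cong (toℕ-injective e) (toℕ-injective (suc-injective e′))
  keyᴾ-injective {q i k h} {r l}      (() , _)
  keyᴾ-injective {r k}     {p i}      (() , _)
  keyᴾ-injective {r k}     {q i l h}  (() , _)
  keyᴾ-injective {r k}     {r l}      (_ , e , _)   = cong r (toℕ-injective e)

  keyᴿ-injective : Injective _≡_ _≈ᴷ_ keyᴿ
  keyᴿ-injective {p i}     {p j}      (_ , e , _)   = cong p (toℕ-injective e)
  keyᴿ-injective {p i}     {q j k h}  (() , _)
  keyᴿ-injective {p i}     {r k}      (() , _)
  keyᴿ-injective {q i k h} {p j}      (() , _)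
  keyᴿ-injective {q i k h} {q j l h′} (_ , e , e′)  =
    q-cong (toℕ-injective (suc-injective e′)) (toℕ-injective e)
  keyᴿ-injective {q i k h} {r l}      (_ , _ , ())
  keyᴿ-injective {r k}     {p i}      (() , _)
  keyᴿ-injective {r k}     {q i l h}  (_ , _ , ())
  keyᴿ-injective {r k}     {r l}      (_ , e , _)   = cong r (toℕ-injective e)

  orders : Fin 4 → LinearOrder V
  orders Fin.zero                               = keyOrder _<_ ascending keyᴾ keyᴾ-injective
  orders (Fin.suc Fin.zero)                     = keyOrder _>_ descending keyᴾ keyᴾ-injective
  orders (Fin.suc (Fin.suc Fin.zero))           = keyOrder _<_ ascending keyᴿ keyᴿ-injective
  orders (Fin.suc (Fin.suc (Fin.suc Fin.zero))) = keyOrder _>_ descending keyᴿ keyᴿ-injective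

  data _⊏_ : V → V → Set where
    p⊏q : ∀ {i k h} → p i ⊏ q i k h
    r⊏q : ∀ {i k h} → r k ⊏ q i k h

  ⊏⇒AdjC : ∀ {a b} → a ⊏ b → AdjC X a b
  ⊏⇒AdjC p⊏q = pq _ _ _
  ⊏⇒AdjC r⊏q = rq _ _ _

  ⊏⇒AdjC-flipped : ∀ {a b} → a ⊏ b → AdjC X b a
  ⊏⇒AdjC-flipped p⊏q = qp _ _ _
  ⊏⇒AdjC-flipped r⊏q = qr _ _ _

  AdjC⇒⊏ : ∀ {a b} → AdjC X a b → a ⊏ b ⊎ b ⊏ a
  AdjC⇒⊏ (pq _ _ _) = inj₁ p⊏q
  AdjC⇒⊏ (qp _ _ _) = inj₂ p⊏q
  AdjC⇒⊏ (qr _ _ _) = inj₂ r⊏q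
  AdjC⇒⊏ (rq _ _ _) = inj₁ r⊏q

  ⊏⇒◁ : ∀ {a b} → a ⊏ b → keyᴾ a ◁ keyᴾ b × keyᴿ a ◁ keyᴿ b
  ⊏⇒◁ p⊏q = within refl refl (s≤s z≤n) , across (s≤s z≤n)
  ⊏⇒◁ r⊏q = across (s≤s z≤n) , within refl refl (s≤s z≤n)

  -- Conversely, going up in both block orders forces an oriented edge:
  -- keyᴾ puts a and b into one star of P, keyᴿ into one star of R.
  ◁⇒⊏ : ∀ a b → keyᴾ a ◁ keyᴾ b → keyᴿ a ◁ keyᴿ b → a ⊏ b
  ◁⇒⊏ (p i)     (p j)      (across (s≤s ()))  _
  ◁⇒⊏ (p i)     (p j)      (within _ _ ())    _
  ◁⇒⊏ (p i)     (q j k h)  (across (s≤s ()))  _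
  ◁⇒⊏ (p i)     (q j k h)  (within _ e _)     _ with refl ← toℕ-injective e = p⊏q
  ◁⇒⊏ (p i)     (r k)      (across ())        _
  ◁⇒⊏ (p i)     (r k)      (within () _ _)    _
  ◁⇒⊏ (q i k h) (p j)      (across (s≤s ()))  _
  ◁⇒⊏ (q i k h) (p j)      (within _ _ ())    _
  ◁⇒⊏ (q i k h) (q j l h′) (across (s≤s ()))  _
  ◁⇒⊏ (q i k h) (q j l h′) (within _ _ _)     (across (s≤s ()))
  ◁⇒⊏ (q i k h) (q j l h′) (within _ e _)     (within _ _ lt) = ⊥-elim (<-irrefl (cong suc e) lt)
  ◁⇒⊏ (q i k h) (r l)      (across ())        _
  ◁⇒⊏ (q i k h) (r l)      (within () _ _)    _
  ◁⇒⊏ (r k)     (p i)      _                  (across ())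
  ◁⇒⊏ (r k)     (p i)      _                  (within () _ _)
  ◁⇒⊏ (r k)     (q i l h)  _                  (across (s≤s ()))
  ◁⇒⊏ (r k)     (q i l h)  _                  (within _ e _) with refl ← toℕ-injective e = r⊏q
  ◁⇒⊏ (r k)     (r l)      _                  (across (s≤s ()))
  ◁⇒⊏ (r k)     (r l)      _                  (within _ _ ())

  Below : V → V → Set
  Below a b = ∀ s → proj₁ (orders s) a b

  Below⇒⊏ : ∀ a b → Below a b → a ⊏ b
  Below⇒⊏ a b below = ◁⇒⊏ a b
    (Lex-up-down⇒◁ (below Fin.zero) (below (Fin.suc Fin.zero)))
    (Lex-up-down⇒◁ (below (Fin.suc (Fin.suc Fin.zero))) (below (Fin.suc (Fin.suc (Fin.suc Fin.zero)))))

  ⊏⇒Below : ∀ {a b} → a ⊏ b → Below a b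
  ⊏⇒Below a⊏b Fin.zero                               = ◁⇒Lex _<_ (proj₁ (⊏⇒◁ a⊏b))
  ⊏⇒Below a⊏b (Fin.suc Fin.zero)                     = ◁⇒Lex _>_ (proj₁ (⊏⇒◁ a⊏b))
  ⊏⇒Below a⊏b (Fin.suc (Fin.suc Fin.zero))           = ◁⇒Lex _<_ (proj₂ (⊏⇒◁ a⊏b))
  ⊏⇒Below a⊏b (Fin.suc (Fin.suc (Fin.suc Fin.zero))) = ◁⇒Lex _>_ (proj₂ (⊏⇒◁ a⊏b))

mainTheorem7 : ∀ {n m} (X : Graph n m) → Connected X → Bipartite X →
    Σ (Fin 4 → LinearOrder (VC X)) λ L →
    ∀ a b → a ≢ b → (ComparableIn L a b ⇔ AdjC X a b)
mainTheorem7 X _ _ = orders , λ a b _ → mk⇔ comparable⇒adjacent adjacent⇒comparable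
  where
  open Construction X
  comparable⇒adjacent : ∀ {a b} → ComparableIn orders a b → AdjC X a b
  comparable⇒adjacent {a} {b} =
    [ (λ below → ⊏⇒AdjC (Below⇒⊏ a b below))
    , (λ above → ⊏⇒AdjC-flipped (Below⇒⊏ b a above)) ]
  adjacent⇒comparable : ∀ {a b} → AdjC X a b → ComparableIn orders a b
  adjacent⇒comparable adj =
    [ (λ a⊏b → inj₁ (⊏⇒Below a⊏b)) , (λ b⊏a → inj₂ (⊏⇒Below b⊏a)) ] (AdjC⇒⊏ adj)
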